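{- The group $\mathrm{GL}_2(\mathcal{O})$ is generated by the matrices $\begin{pmatrix}0&1\\-1&0\end{pmatrix}$, $\begin{pmatrix}u&0\\0&1\end{pmatrix}$ ($u\in\mathcal{O}^\times$) and $\begin{pmatrix}1&v\\0&1\end{pmatrix}$ ($v\in\mathcal{O}$).
   Context: $\mathcal{O}=\mathbb{Z}+\mathbb{Z}i+\mathbb{Z}j+\mathbb{Z}\frac{1+i+j+ij}2$ is the Hurwitz order in the definite quaternion algebra $B=\mathbb{Q}+\mathbb{Q}i+\mathbb{Q}j+\mathbb{Q}ij$ ($i^2=j^2=-1$, $ij=-ji$), and $\mathrm{GL}_2(\mathcal{O})$ is the group of invertible $2\times2$ matrices over $\mathcal{O}$ whose inverse also has entries in $\mathcal{O}$. -}

module Defs where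

open import Data.Rational using (ℚ; 0ℚ; 1ℚ; _+_; _*_; -_; _/_)
open import Data.Integer using (ℤ; +_)
open import Data.Product using (Σ; ∃; _×_; _,_)
open import Relation.Binary.PropositionalEquality using (_≡_)

-- The quaternion algebra B = (-1,-1)_ℚ : q = a + b i + c j + d ij
record B : Set where
  constructor quat
  field
    re ci cj ck : ℚ

open B public

infixl 6 _+B_
infixl 7 _*B_

_+B_ : B → B → B
quat a b c d +B quat a' b' c' d' = quat (a + a') (b + b') (c + c') (d + d')

-B_ : B → B
-B quat a b c d = quat (- a) (- b) (- c) (- d)

-- Hamilton product with i² = j² = -1, k = ij, ij = -ji
_*B_ : B → B → B
quat a1 b1 c1 d1 *B quat a2 b2 c2 d2 =
  quat (a1 * a2 + - (b1 * b2) + - (c1 * c2) + - (d1 * d2))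
       (a1 * b2 + b1 * a2 + c1 * d2 + - (d1 * c2))
       (a1 * c2 + - (b1 * d2) + c1 * a2 + d1 * b2)
       (a1 * d2 + b1 * c2 + - (c1 * b2) + d1 * a2)

0B 1B : B
0B = quat 0ℚ 0ℚ 0ℚ 0ℚ
1B = quat 1ℚ 0ℚ 0ℚ 0ℚ

ℤ→ℚ : ℤ → ℚ
ℤ→ℚ z = z / 1

half : ℚ
half = + 1 / 2

-- a·1 + b·i + c·j + d·(1+i+j+ij)/2
hurwitz : ℤ → ℤ → ℤ → ℤ → B
hurwitz a b c d =
  quat (ℤ→ℚ a + ℤ→ℚ d * half) (ℤ→ℚ b + ℤ→ℚ d * half)
       (ℤ→ℚ c + ℤ→ℚ d * half) (ℤ→ℚ d * half)

InO : B → Set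
InO q = ∃ λ a → ∃ λ b → ∃ λ c → ∃ λ d → q ≡ hurwitz a b c d

IsUnitO : B → Set
IsUnitO u = InO u × Σ B (λ w → InO w × (u *B w ≡ 1B) × (w *B u ≡ 1B))

record Mat2 : Set where
  constructor mat
  field
    m11 m12 m21 m22 : B

_·_ : Mat2 → Mat2 → Mat2
mat a b c d · mat a' b' c' d' =
  mat (a *B a' +B b *B c') (a *B b' +B b *B d')
      (c *B a' +B d *B c') (c *B b' +B d *B d')

I₂ : Mat2
I₂ = mat 1B 0B 0B 1B

EntriesInO : Mat2 → Set
EntriesInO (mat a b c d) = InO a × InO b × InO c × InO d

IsInverse : Mat2 → Mat2 → Set
IsInverse M N = (M · N ≡ I₂) × (N · M ≡ I₂)

InGL2O : Mat2 → Set
InGL2O M = EntriesInO M × Σ Mat2 (λ N → EntriesInO N × IsInverse M N)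

data Gen : Mat2 → Set where
  gen-w : Gen (mat 0B 1B (-B 1B) 0B)
  gen-u : (u : B) → IsUnitO u → Gen (mat u 0B 0B 1B)
  gen-v : (v : B) → InO v → Gen (mat 1B v 0B 1B)

data Generated : Mat2 → Set where
  g-gen : ∀ {M} → Gen M → Generated M
  g-one : Generated I₂
  g-mul : ∀ {M N} → Generated M → Generated N → Generated (M · N)
  g-inv : ∀ {M N} → Generated M → IsInverse M N → Generated N

{-# OPTIONS --safe #-}
-- Write an element of 𝒪 in the basis 1, i, j, ω = (1 + i + j + ij)/2 with integer
-- coordinates; the reduced norm is then an integer quadratic form, multiplicative,
-- and 𝒪 is norm-Euclidean: rounding the four coordinates of 2α γ̄ / N(γ) in the
-- orthogonal basis 1, i, j, ij to integers of equal parity gives q with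
-- N(α − q γ) < N(γ).  Given (a b; c d) ∈ GL₂(𝒪), left multiplication by
-- (0 −1; 1 0)(1 −q; 0 1) replaces c by a − q c, so induction on N(c) reduces to
-- c = 0.  Then a and d are units of 𝒪 and
-- (a b; 0 d) = diag(a, 1) · w⁻¹ diag(d, 1) w · (1 a⁻¹b; 0 1).
-- Conversely the generators lie in GL₂(𝒪), which is closed under products and inverses.
module Submission where

open import Defs
open import Algebra.Bundles using (Ring; RawRing)
import Algebra.Properties.CommutativeSemigroup as CommutativeSemigroupProperties
import Algebra.Properties.Ring as RingProperties
open import Algebra.Structures using (IsRing)
open import Data.Integer as ℤ using (ℤ; +_; -[1+_]; ∣_∣)
open import Data.Integer.DivMod using (_%ℕ_; _/ℕ_; a≡a%ℕn+[a/ℕn]*n; n%ℕd<d)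
import Data.Integer.Properties as ℤ
import Data.Integer.Tactic.RingSolver as ℤ-Tactic
open import Data.Maybe.Base using (Maybe; just; nothing)
open import Data.Nat as ℕ using (ℕ; zero; suc)
open import Data.Nat.Induction using (<-rec)
import Data.Nat.Properties as ℕ
open import Data.Product.Base using (_×_; _,_; proj₁; proj₂; ∃-syntax)
open import Data.Fin using (#_)
open import Data.Rational as ℚ using (ℚ; 0ℚ; 1ℚ)
open import Data.Rational.Literals using (fromℤ)
import Data.Rational.Properties as ℚ
import Data.Rational.Unnormalised as ℚᵘ
import Data.Rational.Unnormalised.Properties as ℚᵘ
open import Data.Sum.Base using (inj₁; inj₂)
open import Data.Vec.Base using (Vec; _∷_; [])
open import Function.Base using (_∘_; id)
open import Level using (0ℓ)
open import Relation.Binary.PropositionalEquality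
open import Relation.Nullary.Decidable using (yes; no)
import Tactic.RingSolver.Core.AlmostCommutativeRing as ACR
open import Tactic.RingSolver.Core.Expression using (Expr; Κ; Ι; _⊕_; _⊗_; ⊝_)
import Tactic.RingSolver.NonReflective as NonReflective

ℚ-ring : ACR.AlmostCommutativeRing 0ℓ 0ℓ
ℚ-ring = ACR.fromCommutativeRing ℚ.+-*-commutativeRing isZero
  where
  isZero : ∀ x → Maybe (0ℚ ≡ x)
  isZero x with 0ℚ ℚ.≟ x
  ... | yes p = just p
  ... | no _  = nothing

module ℤ-Solver = NonReflective ℤ-Tactic.ring

-- Evaluating one of the generic formulas below on variables in this raw ring
-- produces the expression that the non-reflective ring solver normalises; its
-- semantics unfolds definitionally to the same formula over ℚ or ℤ.
expressions : (A : Set) → A → A → ℕ → RawRing 0ℓ 0ℓ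
expressions A 0a 1a n = record
  { Carrier = Expr A n ; _≈_ = _≡_
  ; _+_ = _⊕_ ; _*_ = _⊗_ ; -_ = ⊝_ ; 0# = Κ 0a ; 1# = Κ 1a
  }

ℚ-expr ℤ-expr : ℕ → RawRing 0ℓ 0ℓ
ℚ-expr = expressions ℚ 0ℚ 1ℚ
ℤ-expr = expressions ℤ (+ 0) (+ 1)

record Quad (A : Set) : Set where
  constructor ⟪_,_,_,_⟫
  field
    q₁ qᵢ qⱼ qₖ : A

record Coords (A : Set) : Set where
  constructor ⟨_,_,_,_⟩
  field
    c₁ cᵢ cⱼ cω : A

module QuaternionArithmetic (R : RawRing 0ℓ 0ℓ) where
  open RawRing R

  infixl 6 _+Q_
  infixl 7 _*Q_
  infix 8 -Q_

  _+Q_ : Quad Carrier → Quad Carrier → Quad Carrier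
  ⟪ a , b , c , d ⟫ +Q ⟪ e , f , g , h ⟫ = ⟪ a + e , b + f , c + g , d + h ⟫

  -Q_ : Quad Carrier → Quad Carrier
  -Q ⟪ a , b , c , d ⟫ = ⟪ - a , - b , - c , - d ⟫

  _*Q_ : Quad Carrier → Quad Carrier → Quad Carrier
  ⟪ a₁ , b₁ , c₁ , d₁ ⟫ *Q ⟪ a₂ , b₂ , c₂ , d₂ ⟫ =
    ⟪ a₁ * a₂ + - (b₁ * b₂) + - (c₁ * c₂) + - (d₁ * d₂)
    , a₁ * b₂ + b₁ * a₂ + c₁ * d₂ + - (d₁ * c₂)
    , a₁ * c₂ + - (b₁ * d₂) + c₁ * a₂ + d₁ * b₂
    , a₁ * d₂ + b₁ * c₂ + - (c₁ * b₂) + d₁ * a₂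
    ⟫

  1Q : Quad Carrier
  1Q = ⟪ 1# , 0# , 0# , 0# ⟫

  -- a + b i + c j + d ω with ω = (1 + i + j + ij)/2, given the element standing for 1/2.
  fromCoords : Carrier → Coords Carrier → Quad Carrier
  fromCoords half ⟨ a , b , c , d ⟩ = ⟪ a + d * half , b + d * half , c + d * half , d * half ⟫

  toCoords : Quad Carrier → Coords Carrier
  toCoords ⟪ a , b , c , d ⟫ = ⟨ a + - d , b + - d , c + - d , d + d ⟩

module CoordinateArithmetic (R : RawRing 0ℓ 0ℓ) where
  open RawRing R

  infixl 6 _+ᴴ_ _-ᴴ_
  infixl 7 _*ᴴ_
  infix 8 -ᴴ_

  _+ᴴ_ : Coords Carrier → Coords Carrier → Coords Carrier
  ⟨ a , b , c , d ⟩ +ᴴ ⟨ e , f , g , h ⟩ = ⟨ a + e , b + f , c + g , d + h ⟩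

  -ᴴ_ : Coords Carrier → Coords Carrier
  -ᴴ ⟨ a , b , c , d ⟩ = ⟨ - a , - b , - c , - d ⟩

  _-ᴴ_ : Coords Carrier → Coords Carrier → Coords Carrier
  x -ᴴ y = x +ᴴ -ᴴ y

  -- The structure constants of the basis 1, i, j, ω.
  _*ᴴ_ : Coords Carrier → Coords Carrier → Coords Carrier
  ⟨ a , b , c , d ⟩ *ᴴ ⟨ e , f , g , h ⟩ =
    ⟨ a * e - b * f - b * g - b * h + c * f - c * g - d * g - d * h
    , a * f + b * e - b * g + c * f + c * h + d * f - d * g
    , a * g - b * g - b * h + c * e + c * f + c * h + d * f
    , a * h + b * g + b * g + b * h - c * f - c * f - c * h + d * e - d * f + d * g + d * h
    ⟩
    where
    infixl 6 _-_
    _-_ : Carrier → Carrier → Carrier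
    x - y = x + - y

  conj : Coords Carrier → Coords Carrier
  conj ⟨ a , b , c , d ⟩ = ⟨ a + d , - b , - c , - d ⟩

  norm : Coords Carrier → Carrier
  norm ⟨ a , b , c , d ⟩ = a * a + b * b + c * c + a * d + b * d + c * d + d * d

  scalar : Carrier → Coords Carrier
  scalar n = ⟨ n , 0# , 0# , 0# ⟩

  -- 2x has coordinates (2a + d, 2b + d, 2c + d, d) in the orthogonal basis 1, i, j, ij.
  doubled : Coords Carrier → Coords Carrier
  doubled ⟨ a , b , c , d ⟩ = ⟨ a + a + d , b + b + d , c + c + d , d ⟩

  sumSq : Coords Carrier → Carrier
  sumSq ⟨ p , q , r , s ⟩ = p * p + q * q + r * r + s * s

  -- The element whose doubled orthogonal coordinates are 2 tₖ + ε.
  fromDoubled : Carrier → Carrier → Carrier → Carrier → Carrier → Coords Carrier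
  fromDoubled t₀ t₁ t₂ t₃ ε = ⟨ t₀ + - t₃ , t₁ + - t₃ , t₂ + - t₃ , t₃ + t₃ + ε ⟩

module _ (R : ACR.AlmostCommutativeRing 0ℓ 0ℓ)
         (≈⇒≡ : ∀ {x y} → ACR.AlmostCommutativeRing._≈_ R x y → x ≡ y) where
  open ACR.AlmostCommutativeRing R using (Carrier; _≈_)
  open NonReflective.Ops R using (⟦_⟧; ⟦_⇓⟧; prove)

  -- Each hypothesis is refl when the two sides of that component have the same normal form.
  quad-identity : ∀ {n} (ρ : Vec Carrier n) (L R : Quad (Expr Carrier n)) → let open Quad in
    ⟦ q₁ L ⇓⟧ ρ ≈ ⟦ q₁ R ⇓⟧ ρ → ⟦ qᵢ L ⇓⟧ ρ ≈ ⟦ qᵢ R ⇓⟧ ρ → ⟦ qⱼ L ⇓⟧ ρ ≈ ⟦ qⱼ R ⇓⟧ ρ → ⟦ qₖ L ⇓⟧ ρ ≈ ⟦ qₖ R ⇓⟧ ρ →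
    ⟪ ⟦ q₁ L ⟧ ρ , ⟦ qᵢ L ⟧ ρ , ⟦ qⱼ L ⟧ ρ , ⟦ qₖ L ⟧ ρ ⟫ ≡ ⟪ ⟦ q₁ R ⟧ ρ , ⟦ qᵢ R ⟧ ρ , ⟦ qⱼ R ⟧ ρ , ⟦ qₖ R ⟧ ρ ⟫
  quad-identity ρ L R p₁ pᵢ pⱼ pₖ
    rewrite ≈⇒≡ (prove ρ (Quad.q₁ L) (Quad.q₁ R) p₁) | ≈⇒≡ (prove ρ (Quad.qᵢ L) (Quad.qᵢ R) pᵢ)
          | ≈⇒≡ (prove ρ (Quad.qⱼ L) (Quad.qⱼ R) pⱼ) | ≈⇒≡ (prove ρ (Quad.qₖ L) (Quad.qₖ R) pₖ) = refl

  coords-identity : ∀ {n} (ρ : Vec Carrier n) (L R : Coords (Expr Carrier n)) → let open Coords in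
    ⟦ c₁ L ⇓⟧ ρ ≈ ⟦ c₁ R ⇓⟧ ρ → ⟦ cᵢ L ⇓⟧ ρ ≈ ⟦ cᵢ R ⇓⟧ ρ → ⟦ cⱼ L ⇓⟧ ρ ≈ ⟦ cⱼ R ⇓⟧ ρ → ⟦ cω L ⇓⟧ ρ ≈ ⟦ cω R ⇓⟧ ρ →
    ⟨ ⟦ c₁ L ⟧ ρ , ⟦ cᵢ L ⟧ ρ , ⟦ cⱼ L ⟧ ρ , ⟦ cω L ⟧ ρ ⟩ ≡ ⟨ ⟦ c₁ R ⟧ ρ , ⟦ cᵢ R ⟧ ρ , ⟦ cⱼ R ⟧ ρ , ⟦ cω R ⟧ ρ ⟩
  coords-identity ρ L R p₁ pᵢ pⱼ pω
    rewrite ≈⇒≡ (prove ρ (Coords.c₁ L) (Coords.c₁ R) p₁) | ≈⇒≡ (prove ρ (Coords.cᵢ L) (Coords.cᵢ R) pᵢ)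
          | ≈⇒≡ (prove ρ (Coords.cⱼ L) (Coords.cⱼ R) pⱼ) | ≈⇒≡ (prove ρ (Coords.cω L) (Coords.cω R) pω) = refl

xᵠ : ∀ {A n} → Quad (Expr A (4 ℕ.+ n))
xᵠ = ⟪ Ι (# 0) , Ι (# 1) , Ι (# 2) , Ι (# 3) ⟫

yᵠ : ∀ {A n} → Quad (Expr A (8 ℕ.+ n))
yᵠ = ⟪ Ι (# 4) , Ι (# 5) , Ι (# 6) , Ι (# 7) ⟫

zᵠ : ∀ {A n} → Quad (Expr A (12 ℕ.+ n))
zᵠ = ⟪ Ι (# 8) , Ι (# 9) , Ι (# 10) , Ι (# 11) ⟫

xᶜ : ∀ {A n} → Coords (Expr A (4 ℕ.+ n))
xᶜ = ⟨ Ι (# 0) , Ι (# 1) , Ι (# 2) , Ι (# 3) ⟩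

yᶜ : ∀ {A n} → Coords (Expr A (8 ℕ.+ n))
yᶜ = ⟨ Ι (# 4) , Ι (# 5) , Ι (# 6) , Ι (# 7) ⟩

fromQuad : Quad ℚ → B
fromQuad ⟪ a , b , c , d ⟫ = quat a b c d

quat-≡ : ∀ {a b c d a′ b′ c′ d′} → a ≡ a′ → b ≡ b′ → c ≡ c′ → d ≡ d′ → quat a b c d ≡ quat a′ b′ c′ d′
quat-≡ refl refl refl refl = refl

+B-assoc : ∀ x y z → (x +B y) +B z ≡ x +B (y +B z)
+B-assoc (quat a b c d) (quat e f g h) (quat i j k l) =
  quat-≡ (ℚ.+-assoc a e i) (ℚ.+-assoc b f j) (ℚ.+-assoc c g k) (ℚ.+-assoc d h l)

+B-comm : ∀ x y → x +B y ≡ y +B x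
+B-comm (quat a b c d) (quat e f g h) = quat-≡ (ℚ.+-comm a e) (ℚ.+-comm b f) (ℚ.+-comm c g) (ℚ.+-comm d h)

+B-identityˡ : ∀ x → 0B +B x ≡ x
+B-identityˡ (quat a b c d) = quat-≡ (ℚ.+-identityˡ a) (ℚ.+-identityˡ b) (ℚ.+-identityˡ c) (ℚ.+-identityˡ d)

+B-inverseˡ : ∀ x → -B x +B x ≡ 0B
+B-inverseˡ (quat a b c d) = quat-≡ (ℚ.+-inverseˡ a) (ℚ.+-inverseˡ b) (ℚ.+-inverseˡ c) (ℚ.+-inverseˡ d)

*B-assoc : ∀ x y z → (x *B y) *B z ≡ x *B (y *B z)
*B-assoc (quat a b c d) (quat e f g h) (quat i j k l) = cong fromQuad
  (quad-identity ℚ-ring id (a ∷ b ∷ c ∷ d ∷ e ∷ f ∷ g ∷ h ∷ i ∷ j ∷ k ∷ l ∷ []) (xᵠ *Q yᵠ *Q zᵠ) (xᵠ *Q (yᵠ *Q zᵠ)) refl refl refl refl)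
  where open QuaternionArithmetic (ℚ-expr 12)

*B-identityˡ : ∀ x → 1B *B x ≡ x
*B-identityˡ (quat a b c d) = cong fromQuad (quad-identity ℚ-ring id (a ∷ b ∷ c ∷ d ∷ []) (1Q *Q xᵠ) xᵠ refl refl refl refl)
  where open QuaternionArithmetic (ℚ-expr 4)

*B-identityʳ : ∀ x → x *B 1B ≡ x
*B-identityʳ (quat a b c d) = cong fromQuad (quad-identity ℚ-ring id (a ∷ b ∷ c ∷ d ∷ []) (xᵠ *Q 1Q) xᵠ refl refl refl refl)
  where open QuaternionArithmetic (ℚ-expr 4)

*B-distribˡ : ∀ x y z → x *B (y +B z) ≡ x *B y +B x *B z
*B-distribˡ (quat a b c d) (quat e f g h) (quat i j k l) = cong fromQuad
  (quad-identity ℚ-ring id (a ∷ b ∷ c ∷ d ∷ e ∷ f ∷ g ∷ h ∷ i ∷ j ∷ k ∷ l ∷ []) (xᵠ *Q (yᵠ +Q zᵠ)) (xᵠ *Q yᵠ +Q xᵠ *Q zᵠ) refl refl refl refl)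
  where open QuaternionArithmetic (ℚ-expr 12)

*B-distribʳ : ∀ x y z → (y +B z) *B x ≡ y *B x +B z *B x
*B-distribʳ (quat a b c d) (quat e f g h) (quat i j k l) = cong fromQuad
  (quad-identity ℚ-ring id (a ∷ b ∷ c ∷ d ∷ e ∷ f ∷ g ∷ h ∷ i ∷ j ∷ k ∷ l ∷ []) ((yᵠ +Q zᵠ) *Q xᵠ) (yᵠ *Q xᵠ +Q zᵠ *Q xᵠ) refl refl refl refl)
  where open QuaternionArithmetic (ℚ-expr 12)

B-isRing : IsRing _≡_ _+B_ _*B_ -B_ 0B 1B
B-isRing = record
  { +-isAbelianGroup = record
    { isGroup = record
      { isMonoid = record
        { isSemigroup = record { isMagma = record { isEquivalence = isEquivalence ; ∙-cong = cong₂ _+B_ } ; assoc = +B-assoc }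
        ; identity = +B-identityˡ , λ x → trans (+B-comm x 0B) (+B-identityˡ x)
        }
      ; inverse = +B-inverseˡ , λ x → trans (+B-comm x (-B x)) (+B-inverseˡ x)
      ; ⁻¹-cong = cong -B_
      }
    ; comm = +B-comm
    }
  ; *-cong = cong₂ _*B_
  ; *-assoc = *B-assoc
  ; *-identity = *B-identityˡ , *B-identityʳ
  ; distrib = *B-distribˡ , *B-distribʳ
  }

B-ring : Ring 0ℓ 0ℓ
B-ring = record { isRing = B-isRing }

open Ring B-ring using (zeroˡ; zeroʳ; +-identityʳ; -‿inverseʳ; +-commutativeSemigroup)
open RingProperties B-ring using (-‿distribˡ-*)
open CommutativeSemigroupProperties +-commutativeSemigroup using (interchange)

ι : ℤ → ℚ
ι = ℤ→ℚ

ι≡fromℤ : ∀ z → ι z ≡ fromℤ z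
ι≡fromℤ z = ℚ.fromℚᵘ-toℚᵘ (fromℤ z)

fromℤ-+ : ∀ x y → fromℤ (x ℤ.+ y) ≡ fromℤ x ℚ.+ fromℤ y
fromℤ-+ x y = ℚ.toℚᵘ-injective (ℚᵘ.≃-sym (ℚᵘ.≃-trans (ℚ.toℚᵘ-homo-+ (fromℤ x) (fromℤ y))
  (ℚᵘ.*≡* (cong (ℤ._* + 1) (cong₂ ℤ._+_ (ℤ.*-identityʳ x) (ℤ.*-identityʳ y))))))

fromℤ-* : ∀ x y → fromℤ (x ℤ.* y) ≡ fromℤ x ℚ.* fromℤ y
fromℤ-* x y = ℚ.toℚᵘ-injective (ℚᵘ.≃-sym (ℚᵘ.≃-trans (ℚ.toℚᵘ-homo-* (fromℤ x) (fromℤ y)) (ℚᵘ.*≡* refl)))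

fromℤ-neg : ∀ x → fromℤ (ℤ.- x) ≡ ℚ.- fromℤ x
fromℤ-neg x = ℚ.toℚᵘ-injective (ℚᵘ.≃-sym (ℚᵘ.≃-trans (ℚ.toℚᵘ-homo‿- (fromℤ x)) (ℚᵘ.*≡* refl)))

ι-+ : ∀ x y → ι (x ℤ.+ y) ≡ ι x ℚ.+ ι y
ι-+ x y = trans (ι≡fromℤ _) (trans (fromℤ-+ x y) (sym (cong₂ ℚ._+_ (ι≡fromℤ x) (ι≡fromℤ y))))

ι-* : ∀ x y → ι (x ℤ.* y) ≡ ι x ℚ.* ι y
ι-* x y = trans (ι≡fromℤ _) (trans (fromℤ-* x y) (sym (cong₂ ℚ._*_ (ι≡fromℤ x) (ι≡fromℤ y))))

ι-neg : ∀ x → ι (ℤ.- x) ≡ ℚ.- ι x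
ι-neg x = trans (ι≡fromℤ _) (trans (fromℤ-neg x) (sym (cong ℚ.-_ (ι≡fromℤ x))))

ι-injective : ∀ {x y} → ι x ≡ ι y → x ≡ y
ι-injective {x} {y} eq = cong ℚ.↥_ (trans (sym (ι≡fromℤ x)) (trans eq (ι≡fromℤ y)))

coords-≡ : ∀ {A : Set} {a b c d a′ b′ c′ d′ : A} → a ≡ a′ → b ≡ b′ → c ≡ c′ → d ≡ d′ → ⟨ a , b , c , d ⟩ ≡ ⟨ a′ , b′ , c′ , d′ ⟩
coords-≡ refl refl refl refl = refl

mapᶜ : ∀ {A A′ : Set} → (A → A′) → Coords A → Coords A′
mapᶜ f ⟨ a , b , c , d ⟩ = ⟨ f a , f b , f c , f d ⟩

module ℤᶜ = CoordinateArithmetic ℤ.+-*-rawRing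
module ℚᶜ = CoordinateArithmetic ℚ.+-*-rawRing

-- The graph of ι is closed under the ring operations, so evaluating a
-- coordinate formula there computes the integer formula and its rational
-- image side by side, together with the proof that they correspond.
infix 4 _↦_by_

record ι-Graph : Set where
  constructor _↦_by_
  field
    int : ℤ
    rat : ℚ
    ι-int : ι int ≡ rat
open ι-Graph

ι-graph : RawRing 0ℓ 0ℓ
ι-graph = record
  { Carrier = ι-Graph
  ; _≈_ = _≡_
  ; _+_ = λ { (x ↦ p by eq) (y ↦ q by eq′) → x ℤ.+ y ↦ p ℚ.+ q by trans (ι-+ x y) (cong₂ ℚ._+_ eq eq′) }
  ; _*_ = λ { (x ↦ p by eq) (y ↦ q by eq′) → x ℤ.* y ↦ p ℚ.* q by trans (ι-* x y) (cong₂ ℚ._*_ eq eq′) }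
  ; -_ = λ { (x ↦ p by eq) → ℤ.- x ↦ ℚ.- p by trans (ι-neg x) (cong ℚ.-_ eq) }
  ; 0# = + 0 ↦ 0ℚ by refl
  ; 1# = + 1 ↦ 1ℚ by refl
  }

module Graphᶜ = CoordinateArithmetic ι-graph

graph : Coords ℤ → Coords ι-Graph
graph = mapᶜ λ z → z ↦ ι z by refl

ι-on-graph : (g : Coords ι-Graph) → mapᶜ ι (mapᶜ int g) ≡ mapᶜ rat g
ι-on-graph ⟨ a , b , c , d ⟩ = coords-≡ (ι-int a) (ι-int b) (ι-int c) (ι-int d)

ιᶜ-+ : ∀ x y → mapᶜ ι (x ℤᶜ.+ᴴ y) ≡ mapᶜ ι x ℚᶜ.+ᴴ mapᶜ ι y
ιᶜ-+ x y = ι-on-graph (graph x Graphᶜ.+ᴴ graph y)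

ιᶜ-neg : ∀ x → mapᶜ ι (ℤᶜ.-ᴴ x) ≡ ℚᶜ.-ᴴ mapᶜ ι x
ιᶜ-neg x = ι-on-graph (Graphᶜ.-ᴴ graph x)

ιᶜ-* : ∀ x y → mapᶜ ι (x ℤᶜ.*ᴴ y) ≡ mapᶜ ι x ℚᶜ.*ᴴ mapᶜ ι y
ιᶜ-* x y = ι-on-graph (graph x Graphᶜ.*ᴴ graph y)

toB : Coords ℚ → B
toB ⟨ a , b , c , d ⟩ = quat (a ℚ.+ d ℚ.* half) (b ℚ.+ d ℚ.* half) (c ℚ.+ d ℚ.* half) (d ℚ.* half)

fromB : B → Coords ℚ
fromB (quat a b c d) = ⟨ a ℚ.- d , b ℚ.- d , c ℚ.- d , d ℚ.+ d ⟩

fromB∘toB : ∀ x → fromB (toB x) ≡ x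
fromB∘toB ⟨ a , b , c , d ⟩ =
  coords-identity ℚ-ring id (a ∷ b ∷ c ∷ d ∷ []) (toCoords (fromCoords (Κ half) xᶜ)) xᶜ refl refl refl refl
  where open QuaternionArithmetic (ℚ-expr 4)

toB-+ : ∀ x y → toB (x ℚᶜ.+ᴴ y) ≡ toB x +B toB y
toB-+ ⟨ a , b , c , d ⟩ ⟨ e , f , g , h ⟩ = cong fromQuad (quad-identity ℚ-ring id (a ∷ b ∷ c ∷ d ∷ e ∷ f ∷ g ∷ h ∷ [])
  (fromCoords (Κ half) (xᶜ +ᴴ yᶜ)) (fromCoords (Κ half) xᶜ +Q fromCoords (Κ half) yᶜ) refl refl refl refl)
  where
  open QuaternionArithmetic (ℚ-expr 8)
  open CoordinateArithmetic (ℚ-expr 8)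

toB-neg : ∀ x → toB (ℚᶜ.-ᴴ x) ≡ -B toB x
toB-neg ⟨ a , b , c , d ⟩ = cong fromQuad (quad-identity ℚ-ring id (a ∷ b ∷ c ∷ d ∷ [])
  (fromCoords (Κ half) (-ᴴ xᶜ)) (-Q fromCoords (Κ half) xᶜ) refl refl refl refl)
  where
  open QuaternionArithmetic (ℚ-expr 4)
  open CoordinateArithmetic (ℚ-expr 4)

toB-* : ∀ x y → toB (x ℚᶜ.*ᴴ y) ≡ toB x *B toB y
toB-* ⟨ a , b , c , d ⟩ ⟨ e , f , g , h ⟩ = cong fromQuad (quad-identity ℚ-ring id (a ∷ b ∷ c ∷ d ∷ e ∷ f ∷ g ∷ h ∷ [])
  (fromCoords (Κ half) (xᶜ *ᴴ yᶜ)) (fromCoords (Κ half) xᶜ *Q fromCoords (Κ half) yᶜ) refl refl refl refl)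
  where
  open QuaternionArithmetic (ℚ-expr 8)
  open CoordinateArithmetic (ℚ-expr 8)

-- φ ⟨ a , b , c , d ⟩ is definitionally hurwitz a b c d.
φ : Coords ℤ → B
φ x = toB (mapᶜ ι x)

φ-+ : ∀ x y → φ (x ℤᶜ.+ᴴ y) ≡ φ x +B φ y
φ-+ x y = trans (cong toB (ιᶜ-+ x y)) (toB-+ (mapᶜ ι x) (mapᶜ ι y))

φ-neg : ∀ x → φ (ℤᶜ.-ᴴ x) ≡ -B φ x
φ-neg x = trans (cong toB (ιᶜ-neg x)) (toB-neg (mapᶜ ι x))

φ-* : ∀ x y → φ (x ℤᶜ.*ᴴ y) ≡ φ x *B φ y
φ-* x y = trans (cong toB (ιᶜ-* x y)) (toB-* (mapᶜ ι x) (mapᶜ ι y))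

φ-sub : ∀ x y → φ (x ℤᶜ.-ᴴ y) ≡ φ x +B -B φ y
φ-sub x y = trans (φ-+ x (ℤᶜ.-ᴴ y)) (cong (φ x +B_) (φ-neg y))

mapᶜ-ι-injective : ∀ {x y} → mapᶜ ι x ≡ mapᶜ ι y → x ≡ y
mapᶜ-ι-injective {⟨ _ , _ , _ , _ ⟩} {⟨ _ , _ , _ , _ ⟩} eq =
  coords-≡ (ι-injective (cong Coords.c₁ eq)) (ι-injective (cong Coords.cᵢ eq))
           (ι-injective (cong Coords.cⱼ eq)) (ι-injective (cong Coords.cω eq))

φ-injective : ∀ {x y} → φ x ≡ φ y → x ≡ y
φ-injective {x} {y} eq = mapᶜ-ι-injective (begin
  mapᶜ ι x     ≡⟨ fromB∘toB (mapᶜ ι x) ⟨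
  fromB (φ x)  ≡⟨ cong fromB eq ⟩
  fromB (φ y)  ≡⟨ fromB∘toB (mapᶜ ι y) ⟩
  mapᶜ ι y     ∎)
  where open ≡-Reasoning

φ∈O : ∀ x → InO (φ x)
φ∈O ⟨ a , b , c , d ⟩ = a , b , c , d , refl

coordsOf : ∀ {q} → InO q → Coords ℤ
coordsOf (a , b , c , d , _) = ⟨ a , b , c , d ⟩

coordsOf-φ : ∀ {q} (q∈O : InO q) → q ≡ φ (coordsOf q∈O)
coordsOf-φ (_ , _ , _ , _ , eq) = eq

∈O-φ : ∀ {q} x → q ≡ φ x → InO q
∈O-φ x eq = subst InO (sym eq) (φ∈O x)

∈O-+ : ∀ {p q} → InO p → InO q → InO (p +B q)
∈O-+ P Q = ∈O-φ (coordsOf P ℤᶜ.+ᴴ coordsOf Q)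
  (trans (cong₂ _+B_ (coordsOf-φ P) (coordsOf-φ Q)) (sym (φ-+ (coordsOf P) (coordsOf Q))))

∈O-* : ∀ {p q} → InO p → InO q → InO (p *B q)
∈O-* P Q = ∈O-φ (coordsOf P ℤᶜ.*ᴴ coordsOf Q)
  (trans (cong₂ _*B_ (coordsOf-φ P) (coordsOf-φ Q)) (sym (φ-* (coordsOf P) (coordsOf Q))))

∈O-neg : ∀ {q} → InO q → InO (-B q)
∈O-neg Q = ∈O-φ (ℤᶜ.-ᴴ coordsOf Q) (trans (cong -B_ (coordsOf-φ Q)) (sym (φ-neg (coordsOf Q))))

0∈O : InO 0B
0∈O = φ∈O ⟨ + 0 , + 0 , + 0 , + 0 ⟩

1∈O : InO 1B
1∈O = φ∈O ⟨ + 1 , + 0 , + 0 , + 0 ⟩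

open ℤᶜ
open import Data.Integer.Base using (_+_; _-_; _*_; -_; _<_; _≤_)

norm-* : ∀ x y → norm (x *ᴴ y) ≡ norm x * norm y
norm-* ⟨ a , b , c , d ⟩ ⟨ e , f , g , h ⟩ =
  ℤ-Solver.Ops.prove (a ∷ b ∷ c ∷ d ∷ e ∷ f ∷ g ∷ h ∷ []) (E.norm (xᶜ E.*ᴴ yᶜ)) (E.norm xᶜ ⊗ E.norm yᶜ) refl
  where module E = CoordinateArithmetic (ℤ-expr 8)

norm-conj : ∀ x → norm (conj x) ≡ norm x
norm-conj ⟨ a , b , c , d ⟩ = ℤ-Solver.Ops.prove (a ∷ b ∷ c ∷ d ∷ []) (E.norm (E.conj xᶜ)) (E.norm xᶜ) refl
  where module E = CoordinateArithmetic (ℤ-expr 4)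

*-conj : ∀ x → x *ᴴ conj x ≡ scalar (norm x)
*-conj ⟨ a , b , c , d ⟩ =
  coords-identity ℤ-Tactic.ring id (a ∷ b ∷ c ∷ d ∷ []) (xᶜ E.*ᴴ E.conj xᶜ) (E.scalar (E.norm xᶜ)) refl refl refl refl
  where module E = CoordinateArithmetic (ℤ-expr 4)

sub-*-conj : ∀ α q γ → (α -ᴴ q *ᴴ γ) *ᴴ conj γ ≡ α *ᴴ conj γ -ᴴ q *ᴴ scalar (norm γ)
sub-*-conj α q γ = φ-injective (begin
  φ ((α -ᴴ q *ᴴ γ) *ᴴ conj γ)                      ≡⟨ φ-* (α -ᴴ q *ᴴ γ) (conj γ) ⟩
  φ (α -ᴴ q *ᴴ γ) *B γ̄                            ≡⟨ cong (_*B γ̄) (trans (φ-sub α (q *ᴴ γ)) (cong (λ x → φ α +B -B x) (φ-* q γ))) ⟩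
  (φ α +B -B (φ q *B φ γ)) *B γ̄                   ≡⟨ *B-distribʳ γ̄ (φ α) (-B (φ q *B φ γ)) ⟩
  φ α *B γ̄ +B (-B (φ q *B φ γ)) *B γ̄             ≡⟨ cong (φ α *B γ̄ +B_) (-‿distribˡ-* (φ q *B φ γ) γ̄) ⟨
  φ α *B γ̄ +B -B ((φ q *B φ γ) *B γ̄)             ≡⟨ cong (λ x → φ α *B γ̄ +B -B x) (*B-assoc (φ q) (φ γ) γ̄) ⟩
  φ α *B γ̄ +B -B (φ q *B (φ γ *B γ̄))             ≡⟨ cong (λ x → φ α *B γ̄ +B -B (φ q *B x)) (trans (sym (φ-* γ (conj γ))) (cong φ (*-conj γ))) ⟩
  φ α *B γ̄ +B -B (φ q *B φ (scalar (norm γ)))     ≡⟨ cong₂ (λ x y → x +B -B y) (φ-* α (conj γ)) (φ-* q (scalar (norm γ))) ⟨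
  φ (α *ᴴ conj γ) +B -B φ (q *ᴴ scalar (norm γ))   ≡⟨ φ-sub (α *ᴴ conj γ) (q *ᴴ scalar (norm γ)) ⟨
  φ (α *ᴴ conj γ -ᴴ q *ᴴ scalar (norm γ))          ∎)
  where
  open ≡-Reasoning
  γ̄ : B
  γ̄ = φ (conj γ)

norm-orthogonal : ∀ x → norm x * + 4 ≡ sumSq (doubled x)
norm-orthogonal ⟨ a , b , c , d ⟩ =
  ℤ-Solver.Ops.prove (a ∷ b ∷ c ∷ d ∷ []) (E.norm xᶜ ⊗ Κ (+ 4)) (E.sumSq (E.doubled xᶜ)) refl
  where module E = CoordinateArithmetic (ℤ-expr 4)

square≡∣∣² : ∀ z → z * z ≡ + (∣ z ∣ ℕ.* ∣ z ∣)
square≡∣∣² (+ n)    = sym (ℤ.pos-* n n)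
square≡∣∣² -[1+ n ] = refl

sumSq≡∣∣² : ∀ p q r s → sumSq ⟨ p , q , r , s ⟩ ≡ + (∣ p ∣ ℕ.* ∣ p ∣ ℕ.+ ∣ q ∣ ℕ.* ∣ q ∣ ℕ.+ ∣ r ∣ ℕ.* ∣ r ∣ ℕ.+ ∣ s ∣ ℕ.* ∣ s ∣)
sumSq≡∣∣² p q r s = begin
  sumSq ⟨ p , q , r , s ⟩
    ≡⟨ cong₂ _+_ (cong₂ _+_ (cong₂ _+_ (square≡∣∣² p) (square≡∣∣² q)) (square≡∣∣² r)) (square≡∣∣² s) ⟩
  + (∣ p ∣ ℕ.* ∣ p ∣) + + (∣ q ∣ ℕ.* ∣ q ∣) + + (∣ r ∣ ℕ.* ∣ r ∣) + + (∣ s ∣ ℕ.* ∣ s ∣)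
    ≡⟨ cong (λ z → z + + (∣ r ∣ ℕ.* ∣ r ∣) + + (∣ s ∣ ℕ.* ∣ s ∣)) (ℤ.pos-+ (∣ p ∣ ℕ.* ∣ p ∣) (∣ q ∣ ℕ.* ∣ q ∣)) ⟨
  + (∣ p ∣ ℕ.* ∣ p ∣ ℕ.+ ∣ q ∣ ℕ.* ∣ q ∣) + + (∣ r ∣ ℕ.* ∣ r ∣) + + (∣ s ∣ ℕ.* ∣ s ∣)
    ≡⟨ cong (_+ + (∣ s ∣ ℕ.* ∣ s ∣)) (ℤ.pos-+ (∣ p ∣ ℕ.* ∣ p ∣ ℕ.+ ∣ q ∣ ℕ.* ∣ q ∣) (∣ r ∣ ℕ.* ∣ r ∣)) ⟨
  + (∣ p ∣ ℕ.* ∣ p ∣ ℕ.+ ∣ q ∣ ℕ.* ∣ q ∣ ℕ.+ ∣ r ∣ ℕ.* ∣ r ∣) + + (∣ s ∣ ℕ.* ∣ s ∣)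
    ≡⟨ ℤ.pos-+ (∣ p ∣ ℕ.* ∣ p ∣ ℕ.+ ∣ q ∣ ℕ.* ∣ q ∣ ℕ.+ ∣ r ∣ ℕ.* ∣ r ∣) (∣ s ∣ ℕ.* ∣ s ∣) ⟨
  + (∣ p ∣ ℕ.* ∣ p ∣ ℕ.+ ∣ q ∣ ℕ.* ∣ q ∣ ℕ.+ ∣ r ∣ ℕ.* ∣ r ∣ ℕ.+ ∣ s ∣ ℕ.* ∣ s ∣) ∎
  where open ≡-Reasoning

0≤norm : ∀ x → + 0 ≤ norm x
0≤norm x@(⟨ a , b , c , d ⟩) = ℤ.*-cancelʳ-≤-pos (+ 0) (norm x) (+ 4)
  (subst (+ 0 ≤_) (sym (trans (norm-orthogonal x) (sumSq≡∣∣² (a + a + d) (b + b + d) (c + c + d) d))) (ℤ.+≤+ ℕ.z≤n))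

‖_‖ : Coords ℤ → ℕ
‖ x ‖ = ∣ norm x ∣

norm≡‖‖ : ∀ x → norm x ≡ + ‖ x ‖
norm≡‖‖ x = sym (ℤ.0≤i⇒+∣i∣≡i (0≤norm x))

square≡0 : ∀ z → ∣ z ∣ ℕ.* ∣ z ∣ ≡ 0 → z ≡ + 0
square≡0 z eq with ℕ.m*n≡0⇒m≡0∨n≡0 ∣ z ∣ eq
... | inj₁ ∣z∣≡0 = ℤ.∣i∣≡0⇒i≡0 ∣z∣≡0
... | inj₂ ∣z∣≡0 = ℤ.∣i∣≡0⇒i≡0 ∣z∣≡0

double≡0 : ∀ a d → a + a + d ≡ + 0 → d ≡ + 0 → a ≡ + 0
double≡0 a d eq refl = ℤ.*-cancelˡ-≡ (+ 2) a (+ 0) (trans (twice a) eq)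
  where
  twice : ∀ a → + 2 * a ≡ a + a + + 0
  twice = ℤ-Tactic.solve-∀

‖‖≡0 : ∀ x → ‖ x ‖ ≡ 0 → x ≡ ⟨ + 0 , + 0 , + 0 , + 0 ⟩
‖‖≡0 x@(⟨ a , b , c , d ⟩) eq =
  coords-≡ (double≡0 a d Y₀≡0 Y₃≡0) (double≡0 b d Y₁≡0 Y₃≡0) (double≡0 c d Y₂≡0 Y₃≡0) Y₃≡0
  where
  S₀ S₁ S₂ S₃ : ℕ
  S₀ = ∣ a + a + d ∣ ℕ.* ∣ a + a + d ∣
  S₁ = ∣ b + b + d ∣ ℕ.* ∣ b + b + d ∣
  S₂ = ∣ c + c + d ∣ ℕ.* ∣ c + c + d ∣
  S₃ = ∣ d ∣ ℕ.* ∣ d ∣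
  S≡0 : S₀ ℕ.+ S₁ ℕ.+ S₂ ℕ.+ S₃ ≡ 0
  S≡0 = ℤ.+-injective (begin
    + (S₀ ℕ.+ S₁ ℕ.+ S₂ ℕ.+ S₃)   ≡⟨ sumSq≡∣∣² (a + a + d) (b + b + d) (c + c + d) d ⟨
    sumSq (doubled x)             ≡⟨ norm-orthogonal x ⟨
    norm x * + 4                  ≡⟨ cong (_* + 4) (trans (norm≡‖‖ x) (cong +_ eq)) ⟩
    + 0                           ∎)
    where open ≡-Reasoning
  S₀₁₂≡0 : S₀ ℕ.+ S₁ ℕ.+ S₂ ≡ 0
  S₀₁₂≡0 = ℕ.m+n≡0⇒m≡0 (S₀ ℕ.+ S₁ ℕ.+ S₂) S≡0
  S₀₁≡0 : S₀ ℕ.+ S₁ ≡ 0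
  S₀₁≡0 = ℕ.m+n≡0⇒m≡0 (S₀ ℕ.+ S₁) S₀₁₂≡0
  Y₀≡0 : a + a + d ≡ + 0
  Y₀≡0 = square≡0 (a + a + d) (ℕ.m+n≡0⇒m≡0 S₀ S₀₁≡0)
  Y₁≡0 : b + b + d ≡ + 0
  Y₁≡0 = square≡0 (b + b + d) (ℕ.m+n≡0⇒n≡0 S₀ S₀₁≡0)
  Y₂≡0 : c + c + d ≡ + 0
  Y₂≡0 = square≡0 (c + c + d) (ℕ.m+n≡0⇒n≡0 (S₀ ℕ.+ S₁) S₀₁₂≡0)
  Y₃≡0 : d ≡ + 0
  Y₃≡0 = square≡0 d (ℕ.m+n≡0⇒n≡0 (S₀ ℕ.+ S₁ ℕ.+ S₂) S≡0)

doubled-remainder₀ : ∀ y t₀ t₁ t₂ t₃ n → doubled (y -ᴴ fromDoubled t₀ t₁ t₂ t₃ (+ 0) *ᴴ scalar n) ≡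
                     doubled y -ᴴ ⟨ n * (t₀ + t₀) , n * (t₁ + t₁) , n * (t₂ + t₂) , n * (t₃ + t₃) ⟩
doubled-remainder₀ ⟨ a , b , c , d ⟩ t₀ t₁ t₂ t₃ n =
  coords-identity ℤ-Tactic.ring id (a ∷ b ∷ c ∷ d ∷ t₀ ∷ t₁ ∷ t₂ ∷ t₃ ∷ n ∷ [])
    (E.doubled (xᶜ E.-ᴴ E.fromDoubled T₀ T₁ T₂ T₃ (Κ (+ 0)) E.*ᴴ E.scalar N))
    (E.doubled xᶜ E.-ᴴ ⟨ N ⊗ (T₀ ⊕ T₀) , N ⊗ (T₁ ⊕ T₁) , N ⊗ (T₂ ⊕ T₂) , N ⊗ (T₃ ⊕ T₃) ⟩)
    refl refl refl refl
  where
  module E = CoordinateArithmetic (ℤ-expr 9)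
  T₀ T₁ T₂ T₃ N : Expr ℤ 9
  T₀ = Ι (# 4) ; T₁ = Ι (# 5) ; T₂ = Ι (# 6) ; T₃ = Ι (# 7) ; N = Ι (# 8)

doubled-remainder₁ : ∀ y t₀ t₁ t₂ t₃ n → doubled (y -ᴴ fromDoubled t₀ t₁ t₂ t₃ (+ 1) *ᴴ scalar n) ≡
                     doubled y -ᴴ ⟨ n * (t₀ + t₀) , n * (t₁ + t₁) , n * (t₂ + t₂) , n * (t₃ + t₃) ⟩ -ᴴ ⟨ n , n , n , n ⟩
doubled-remainder₁ ⟨ a , b , c , d ⟩ t₀ t₁ t₂ t₃ n =
  coords-identity ℤ-Tactic.ring id (a ∷ b ∷ c ∷ d ∷ t₀ ∷ t₁ ∷ t₂ ∷ t₃ ∷ n ∷ [])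
    (E.doubled (xᶜ E.-ᴴ E.fromDoubled T₀ T₁ T₂ T₃ (Κ (+ 1)) E.*ᴴ E.scalar N))
    (E.doubled xᶜ E.-ᴴ ⟨ N ⊗ (T₀ ⊕ T₀) , N ⊗ (T₁ ⊕ T₁) , N ⊗ (T₂ ⊕ T₂) , N ⊗ (T₃ ⊕ T₃) ⟩ E.-ᴴ ⟨ N , N , N , N ⟩)
    refl refl refl refl
  where
  module E = CoordinateArithmetic (ℤ-expr 9)
  T₀ T₁ T₂ T₃ N : Expr ℤ 9
  T₀ = Ι (# 4) ; T₁ = Ι (# 5) ; T₂ = Ι (# 6) ; T₃ = Ι (# 7) ; N = Ι (# 8)

-- For 0 ≤ r ≤ 2m + 1 and s = 2m + 1 − r: (r − m)² ≤ (m + 1)² with defect s (r + 1).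
square-defect : ∀ r s m → r + s ≡ m + (+ 1 + m) → (r - m) * (r - m) + s * (+ 1 + r) ≡ (+ 1 + m) * (+ 1 + m)
square-defect r s m eq = begin
  (r - m) * (r - m) + s * (+ 1 + r)                      ≡⟨ cong (λ z → (r - m) * (r - m) + z * (+ 1 + r)) s≡ ⟩
  (r - m) * (r - m) + (m + (+ 1 + m) - r) * (+ 1 + r)    ≡⟨ expand r m ⟩
  (+ 1 + m) * (+ 1 + m)                                  ∎
  where
  open ≡-Reasoning
  cancel : ∀ r s → s ≡ r + s - r
  cancel = ℤ-Tactic.solve-∀
  expand : ∀ r m → (r - m) * (r - m) + (m + (+ 1 + m) - r) * (+ 1 + r) ≡ (+ 1 + m) * (+ 1 + m)
  expand = ℤ-Tactic.solve-∀
  s≡ : s ≡ m + (+ 1 + m) - r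
  s≡ = trans (cancel r s) (cong (_- r) eq)

top-residue : ∀ r m → r ≡ m + (+ 1 + m) → r - m ≡ + 1 + m
top-residue r m eq = trans (cong (_- m) eq) (cancel m)
  where
  cancel : ∀ m → m + (+ 1 + m) - m ≡ + 1 + m
  cancel = ℤ-Tactic.solve-∀

-- Division of Y by 2(m + 1) with residue in (−(m + 1), m + 1]; the slack is
-- the distance of the residue from the top of that interval.
record CentredDivision (Y : ℤ) (m : ℕ) : Set where
  field
    quotient : ℤ
    rem slack : ℕ
    rem+slack : rem ℕ.+ slack ≡ m ℕ.+ suc m
    residue-eq : Y - + suc m * (quotient + quotient) ≡ + rem - + m

  residue : ℤ
  residue = + rem - + m

  defect : ℕ
  defect = slack ℕ.* suc rem

  residue²+defect : residue * residue + + defect ≡ + suc m * + suc m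
  residue²+defect = trans (cong (λ z → residue * residue + z) (ℤ.pos-* slack (suc rem)))
    (square-defect (+ rem) (+ slack) (+ m) (trans (sym (ℤ.pos-+ rem slack)) (trans (cong +_ rem+slack) (ℤ.pos-+ m (suc m)))))

  residue-at-top : defect ≡ 0 → residue ≡ + suc m
  residue-at-top defect≡0 = top-residue (+ rem) (+ m) (trans (cong +_ rem≡) (ℤ.pos-+ m (suc m)))
    where
    rem≡ : rem ≡ m ℕ.+ suc m
    rem≡ = trans (sym (ℕ.+-identityʳ rem))
           (subst (λ s → rem ℕ.+ s ≡ m ℕ.+ suc m) (ℕ.m*n≡0⇒m≡0 slack (suc rem) defect≡0) rem+slack)

open CentredDivision

residue-shift : ∀ Y M N R T → Y + M ≡ R + T * (N + N) → Y - N * (T + T) ≡ R - M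
residue-shift Y M N R T eq = begin
  Y - N * (T + T)                    ≡⟨ regroup Y M N T ⟩
  Y + M - T * (N + N) - M            ≡⟨ cong (λ z → z - T * (N + N) - M) eq ⟩
  R + T * (N + N) - T * (N + N) - M  ≡⟨ cancel M N R T ⟩
  R - M                              ∎
  where
  open ≡-Reasoning
  regroup : ∀ Y M N T → Y - N * (T + T) ≡ Y + M - T * (N + N) - M
  regroup = ℤ-Tactic.solve-∀
  cancel : ∀ M N R T → R + T * (N + N) - T * (N + N) - M ≡ R - M
  cancel = ℤ-Tactic.solve-∀

centredDivision : ∀ Y m → CentredDivision Y m
centredDivision Y m = record
  { quotient = X /ℕ d
  ; rem = X %ℕ d
  ; slack = (m ℕ.+ suc m) ℕ.∸ (X %ℕ d)
  ; rem+slack = ℕ.m+[n∸m]≡n (ℕ.s≤s⁻¹ (n%ℕd<d X d))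
  ; residue-eq = residue-shift Y (+ m) (+ suc m) (+ (X %ℕ d)) (X /ℕ d)
      (trans (a≡a%ℕn+[a/ℕn]*n X d) (cong (λ z → + (X %ℕ d) + (X /ℕ d) * z) (ℤ.pos-+ (suc m) (suc m))))
  }
  where
  d : ℕ
  d = suc m ℕ.+ suc m
  X : ℤ
  X = Y + + m

four-defects : ∀ e₀ e₁ e₂ e₃ D₀ D₁ D₂ D₃ N →
  e₀ * e₀ + D₀ ≡ N * N → e₁ * e₁ + D₁ ≡ N * N → e₂ * e₂ + D₂ ≡ N * N → e₃ * e₃ + D₃ ≡ N * N →
  sumSq ⟨ e₀ , e₁ , e₂ , e₃ ⟩ + (D₀ + D₁ + D₂ + D₃) ≡ N * N * + 4
four-defects e₀ e₁ e₂ e₃ D₀ D₁ D₂ D₃ N p₀ p₁ p₂ p₃ = begin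
  sumSq ⟨ e₀ , e₁ , e₂ , e₃ ⟩ + (D₀ + D₁ + D₂ + D₃)                      ≡⟨ regroup e₀ e₁ e₂ e₃ D₀ D₁ D₂ D₃ ⟩
  (e₀ * e₀ + D₀) + (e₁ * e₁ + D₁) + (e₂ * e₂ + D₂) + (e₃ * e₃ + D₃)    ≡⟨ cong₂ _+_ (cong₂ _+_ (cong₂ _+_ p₀ p₁) p₂) p₃ ⟩
  N * N + N * N + N * N + N * N                                        ≡⟨ fourfold N ⟩
  N * N * + 4                                                          ∎
  where
  open ≡-Reasoning
  regroup : ∀ e₀ e₁ e₂ e₃ D₀ D₁ D₂ D₃ → e₀ * e₀ + e₁ * e₁ + e₂ * e₂ + e₃ * e₃ + (D₀ + D₁ + D₂ + D₃) ≡
                                         (e₀ * e₀ + D₀) + (e₁ * e₁ + D₁) + (e₂ * e₂ + D₂) + (e₃ * e₃ + D₃)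
  regroup = ℤ-Tactic.solve-∀
  fourfold : ∀ N → N * N + N * N + N * N + N * N ≡ N * N * + 4
  fourfold = ℤ-Tactic.solve-∀

+-suc⇒< : ∀ {x y} k → x + + suc k ≡ y → x < y
+-suc⇒< {x} k eq = ℤ.suc[i]≤j⇒i<j (subst (+ 1 + x ≤_) (trans (reassoc x (+ k)) eq) (ℤ.i≤i+j (+ 1 + x) (+ k)))
  where
  reassoc : ∀ x K → + 1 + x + K ≡ x + (+ 1 + K)
  reassoc = ℤ-Tactic.solve-∀

module Rounding {a b c d m} (D₀ : CentredDivision (a + a + d) m) (D₁ : CentredDivision (b + b + d) m)
                            (D₂ : CentredDivision (c + c + d) m) (D₃ : CentredDivision d m) where
  n : ℤ
  n = + suc m

  defects : ℕ
  defects = defect D₀ ℕ.+ defect D₁ ℕ.+ defect D₂ ℕ.+ defect D₃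

  t₀ t₁ t₂ t₃ : ℤ
  t₀ = quotient D₀
  t₁ = quotient D₁
  t₂ = quotient D₂
  t₃ = quotient D₃

  rounded : ℤ → Coords ℤ
  rounded = fromDoubled t₀ t₁ t₂ t₃

  remainder : ℤ → Coords ℤ
  remainder ε = ⟨ a , b , c , d ⟩ -ᴴ rounded ε *ᴴ scalar n

  rounded-down : ∀ k → defects ≡ suc k → norm (remainder (+ 0)) < n * n
  rounded-down k defects≡ = ℤ.*-cancelʳ-<-nonNeg (+ 4) (+-suc⇒< k (begin
    norm (remainder (+ 0)) * + 4 + + suc k
      ≡⟨ cong₂ _+_ (norm-orthogonal (remainder (+ 0))) (cong +_ (sym defects≡)) ⟩
    sumSq (doubled (remainder (+ 0))) + + defects
      ≡⟨ cong₂ _+_ (cong sumSq (trans (doubled-remainder₀ ⟨ a , b , c , d ⟩ t₀ t₁ t₂ t₃ n)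
                     (coords-≡ (residue-eq D₀) (residue-eq D₁) (residue-eq D₂) (residue-eq D₃)))) defects-ℤ ⟩
    sumSq ⟨ residue D₀ , residue D₁ , residue D₂ , residue D₃ ⟩ + (+ defect D₀ + + defect D₁ + + defect D₂ + + defect D₃)
      ≡⟨ four-defects (residue D₀) (residue D₁) (residue D₂) (residue D₃) (+ defect D₀) (+ defect D₁) (+ defect D₂) (+ defect D₃) n
                      (residue²+defect D₀) (residue²+defect D₁) (residue²+defect D₂) (residue²+defect D₃) ⟩
    n * n * + 4 ∎))
    where
    open ≡-Reasoning
    defects-ℤ : + defects ≡ + defect D₀ + + defect D₁ + + defect D₂ + + defect D₃
    defects-ℤ = trans (ℤ.pos-+ (defect D₀ ℕ.+ defect D₁ ℕ.+ defect D₂) (defect D₃))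
                (cong (_+ + defect D₃) (trans (ℤ.pos-+ (defect D₀ ℕ.+ defect D₁) (defect D₂))
                (cong (_+ + defect D₂) (ℤ.pos-+ (defect D₀) (defect D₁)))))

  rounded-up : defects ≡ 0 → norm (remainder (+ 1)) ≡ + 0
  rounded-up defects≡0 = ℤ.*-cancelʳ-≡ (norm (remainder (+ 1))) (+ 0) (+ 4)
    (trans (norm-orthogonal (remainder (+ 1))) (cong sumSq (trans (doubled-remainder₁ ⟨ a , b , c , d ⟩ t₀ t₁ t₂ t₃ n)
      (coords-≡ (exact D₀ (ℕ.m+n≡0⇒m≡0 (defect D₀) D₀₁≡0)) (exact D₁ (ℕ.m+n≡0⇒n≡0 (defect D₀) D₀₁≡0))
                (exact D₂ (ℕ.m+n≡0⇒n≡0 (defect D₀ ℕ.+ defect D₁) D₀₁₂≡0))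
                (exact D₃ (ℕ.m+n≡0⇒n≡0 (defect D₀ ℕ.+ defect D₁ ℕ.+ defect D₂) defects≡0))))))
    where
    D₀₁₂≡0 : defect D₀ ℕ.+ defect D₁ ℕ.+ defect D₂ ≡ 0
    D₀₁₂≡0 = ℕ.m+n≡0⇒m≡0 (defect D₀ ℕ.+ defect D₁ ℕ.+ defect D₂) defects≡0
    D₀₁≡0 : defect D₀ ℕ.+ defect D₁ ≡ 0
    D₀₁≡0 = ℕ.m+n≡0⇒m≡0 (defect D₀ ℕ.+ defect D₁) D₀₁₂≡0
    exact : ∀ {Y} (D : CentredDivision Y m) → defect D ≡ 0 → Y - n * (quotient D + quotient D) - n ≡ + 0
    exact D D≡0 = trans (cong (_- n) (trans (residue-eq D) (residue-at-top D D≡0))) (ℤ.+-inverseʳ n)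

  -- Round the doubled orthogonal coordinates to multiples of 2n; if every
  -- residue is the extreme value n, rounding all of them up instead is exact.
  rounding : ∃[ q ] norm (⟨ a , b , c , d ⟩ -ᴴ q *ᴴ scalar n) < n * n
  rounding with defects in defects≡
  ... | zero  = rounded (+ 1) , subst (_< n * n) (sym (rounded-up defects≡)) (ℤ.+<+ (ℕ.s≤s ℕ.z≤n))
  ... | suc k = rounded (+ 0) , rounded-down k defects≡

division : ∀ y m → ∃[ q ] norm (y -ᴴ q *ᴴ scalar (+ suc m)) < + suc m * + suc m
division ⟨ a , b , c , d ⟩ m = Rounding.rounding {a} {b} {c} {d}
  (centredDivision (a + a + d) m) (centredDivision (b + b + d) m) (centredDivision (c + c + d) m) (centredDivision d m)

euclidean : ∀ α γ {m} → ‖ γ ‖ ≡ suc m → ∃[ q ] ‖ α -ᴴ q *ᴴ γ ‖ ℕ.< suc m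
euclidean α γ {m} ‖γ‖≡n with division (α *ᴴ conj γ) m
... | q , bound = q , ℤ.drop‿+<+ (subst (_< n) (norm≡‖‖ ρ) (ℤ.*-cancelʳ-<-nonNeg n (subst (_< n * n) remainder≡ bound)))
  where
  open ≡-Reasoning
  n : ℤ
  n = + suc m
  ρ : Coords ℤ
  ρ = α -ᴴ q *ᴴ γ
  normγ≡n : norm γ ≡ n
  normγ≡n = trans (norm≡‖‖ γ) (cong +_ ‖γ‖≡n)
  remainder≡ : norm (α *ᴴ conj γ -ᴴ q *ᴴ scalar n) ≡ norm ρ * n
  remainder≡ = begin
    norm (α *ᴴ conj γ -ᴴ q *ᴴ scalar n)          ≡⟨ cong (λ z → norm (α *ᴴ conj γ -ᴴ q *ᴴ scalar z)) normγ≡n ⟨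
    norm (α *ᴴ conj γ -ᴴ q *ᴴ scalar (norm γ))   ≡⟨ cong norm (sub-*-conj α q γ) ⟨
    norm (ρ *ᴴ conj γ)                           ≡⟨ norm-* ρ (conj γ) ⟩
    norm ρ * norm (conj γ)                       ≡⟨ cong (norm ρ *_) (trans (norm-conj γ) normγ≡n) ⟩
    norm ρ * n                                   ∎

-- yx = 1 forces N(x) = 1, so x x̄ = 1 and y = y x x̄ = x̄.
inverseˡ⇒inverseʳ : ∀ {x y} → InO x → InO y → y *B x ≡ 1B → x *B y ≡ 1B
inverseˡ⇒inverseʳ {x} {y} x∈O y∈O yx≡1 = begin
  x *B y          ≡⟨ cong (x *B_) y≡x̄ ⟩
  x *B φ (conj X) ≡⟨ xx̄≡1 ⟩
  1B              ∎
  where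
  open ≡-Reasoning
  X Y : Coords ℤ
  X = coordsOf x∈O
  Y = coordsOf y∈O
  YX≡1 : Y *ᴴ X ≡ scalar (+ 1)
  YX≡1 = φ-injective (begin
    φ (Y *ᴴ X)     ≡⟨ φ-* Y X ⟩
    φ Y *B φ X    ≡⟨ cong₂ _*B_ (coordsOf-φ y∈O) (coordsOf-φ x∈O) ⟨
    y *B x        ≡⟨ yx≡1 ⟩
    1B            ∎)
  ‖X‖≡1 : ‖ X ‖ ≡ 1
  ‖X‖≡1 = ℕ.m*n≡1⇒n≡1 ‖ Y ‖ ‖ X ‖ (begin
    ‖ Y ‖ ℕ.* ‖ X ‖         ≡⟨ ℤ.abs-* (norm Y) (norm X) ⟨
    ∣ norm Y * norm X ∣      ≡⟨ cong ∣_∣ (norm-* Y X) ⟨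
    ‖ Y *ᴴ X ‖               ≡⟨ cong ‖_‖ YX≡1 ⟩
    1                       ∎)
  xx̄≡1 : x *B φ (conj X) ≡ 1B
  xx̄≡1 = begin
    x *B φ (conj X)     ≡⟨ cong (_*B φ (conj X)) (coordsOf-φ x∈O) ⟩
    φ X *B φ (conj X)   ≡⟨ φ-* X (conj X) ⟨
    φ (X *ᴴ conj X)      ≡⟨ cong φ (*-conj X) ⟩
    φ (scalar (norm X)) ≡⟨ cong (φ ∘ scalar) (trans (norm≡‖‖ X) (cong +_ ‖X‖≡1)) ⟩
    1B                  ∎
  y≡x̄ : y ≡ φ (conj X)
  y≡x̄ = begin
    y                         ≡⟨ *B-identityʳ y ⟨
    y *B 1B                   ≡⟨ cong (y *B_) xx̄≡1 ⟨
    y *B (x *B φ (conj X))    ≡⟨ *B-assoc y x (φ (conj X)) ⟨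
    (y *B x) *B φ (conj X)    ≡⟨ cong (_*B φ (conj X)) yx≡1 ⟩
    1B *B φ (conj X)          ≡⟨ *B-identityˡ (φ (conj X)) ⟩
    φ (conj X)                ∎

mat-≡ : ∀ {a b c d a′ b′ c′ d′} → a ≡ a′ → b ≡ b′ → c ≡ c′ → d ≡ d′ → mat a b c d ≡ mat a′ b′ c′ d′
mat-≡ refl refl refl refl = refl

entry-assoc : ∀ a b a′ b′ c′ d′ x y →
  (a *B a′ +B b *B c′) *B x +B (a *B b′ +B b *B d′) *B y ≡ a *B (a′ *B x +B b′ *B y) +B b *B (c′ *B x +B d′ *B y)
entry-assoc a b a′ b′ c′ d′ x y = begin
  (a *B a′ +B b *B c′) *B x +B (a *B b′ +B b *B d′) *B y
    ≡⟨ cong₂ _+B_ (*B-distribʳ x (a *B a′) (b *B c′)) (*B-distribʳ y (a *B b′) (b *B d′)) ⟩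
  ((a *B a′) *B x +B (b *B c′) *B x) +B ((a *B b′) *B y +B (b *B d′) *B y)
    ≡⟨ cong₂ _+B_ (cong₂ _+B_ (*B-assoc a a′ x) (*B-assoc b c′ x)) (cong₂ _+B_ (*B-assoc a b′ y) (*B-assoc b d′ y)) ⟩
  (a *B (a′ *B x) +B b *B (c′ *B x)) +B (a *B (b′ *B y) +B b *B (d′ *B y))
    ≡⟨ interchange (a *B (a′ *B x)) (b *B (c′ *B x)) (a *B (b′ *B y)) (b *B (d′ *B y)) ⟩
  (a *B (a′ *B x) +B a *B (b′ *B y)) +B (b *B (c′ *B x) +B b *B (d′ *B y))
    ≡⟨ cong₂ _+B_ (*B-distribˡ a (a′ *B x) (b′ *B y)) (*B-distribˡ b (c′ *B x) (d′ *B y)) ⟨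
  a *B (a′ *B x +B b′ *B y) +B b *B (c′ *B x +B d′ *B y) ∎
  where open ≡-Reasoning

·-assoc : ∀ M N P → (M · N) · P ≡ M · (N · P)
·-assoc (mat a b c d) (mat a′ b′ c′ d′) (mat a″ b″ c″ d″) =
  mat-≡ (entry-assoc a b a′ b′ c′ d′ a″ c″) (entry-assoc a b a′ b′ c′ d′ b″ d″)
        (entry-assoc c d a′ b′ c′ d′ a″ c″) (entry-assoc c d a′ b′ c′ d′ b″ d″)

·-identityˡ : ∀ M → I₂ · M ≡ M
·-identityˡ (mat a b c d) = mat-≡ (first a c) (first b d) (second a c) (second b d)
  where
  first : ∀ x y → 1B *B x +B 0B *B y ≡ x
  first x y = trans (cong₂ _+B_ (*B-identityˡ x) (zeroˡ y)) (+-identityʳ x)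
  second : ∀ x y → 0B *B x +B 1B *B y ≡ y
  second x y = trans (cong₂ _+B_ (zeroˡ x) (*B-identityˡ y)) (+B-identityˡ y)

·-identityʳ : ∀ M → M · I₂ ≡ M
·-identityʳ (mat a b c d) = mat-≡ (first a b) (second a b) (first c d) (second c d)
  where
  first : ∀ x y → x *B 1B +B y *B 0B ≡ x
  first x y = trans (cong₂ _+B_ (*B-identityʳ x) (zeroʳ y)) (+-identityʳ x)
  second : ∀ x y → x *B 0B +B y *B 1B ≡ y
  second x y = trans (cong₂ _+B_ (zeroʳ x) (*B-identityʳ y)) (+B-identityˡ y)

inverse-sym : ∀ M N → IsInverse M N → IsInverse N M
inverse-sym _ _ (MN≡I , NM≡I) = NM≡I , MN≡I

inverse-unique : ∀ M N N′ → IsInverse M N → IsInverse M N′ → N ≡ N′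
inverse-unique M N N′ (_ , NM≡I) (MN′≡I , _) = begin
  N              ≡⟨ ·-identityʳ N ⟨
  N · I₂         ≡⟨ cong (N ·_) MN′≡I ⟨
  N · (M · N′)   ≡⟨ ·-assoc N M N′ ⟨
  (N · M) · N′   ≡⟨ cong (_· N′) NM≡I ⟩
  I₂ · N′        ≡⟨ ·-identityˡ N′ ⟩
  N′             ∎
  where open ≡-Reasoning

cancel-inverse : ∀ N M P → N · M ≡ I₂ → N · (M · P) ≡ P
cancel-inverse N M P NM≡I = trans (sym (·-assoc N M P)) (trans (cong (_· P) NM≡I) (·-identityˡ P))

inverse-· : ∀ M M′ N N′ → IsInverse M M′ → IsInverse N N′ → IsInverse (M · N) (N′ · M′)
inverse-· M M′ N N′ (MM′≡I , M′M≡I) (NN′≡I , N′N≡I) =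
  product-inverse M M′ N N′ MM′≡I NN′≡I , product-inverse N′ N M′ M N′N≡I M′M≡I
  where
  product-inverse : ∀ A A′ C C′ → A · A′ ≡ I₂ → C · C′ ≡ I₂ → (A · C) · (C′ · A′) ≡ I₂
  product-inverse A A′ C C′ AA′≡I CC′≡I = begin
    (A · C) · (C′ · A′) ≡⟨ ·-assoc A C (C′ · A′) ⟩
    A · (C · (C′ · A′)) ≡⟨ cong (A ·_) (cancel-inverse C C′ A′ CC′≡I) ⟩
    A · A′              ≡⟨ AA′≡I ⟩
    I₂                  ∎
    where open ≡-Reasoning

W W⁻¹ : Mat2
W   = mat 0B 1B (-B 1B) 0B
W⁻¹ = mat 0B (-B 1B) 1B 0B

diag : B → Mat2
diag u = mat u 0B 0B 1B

elem : B → Mat2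
elem v = mat 1B v 0B 1B

W-inverse : IsInverse W W⁻¹
W-inverse = refl , refl

W⁻¹-generated : Generated W⁻¹
W⁻¹-generated = g-inv {W} {W⁻¹} (g-gen gen-w) W-inverse

upper-· : ∀ a b d a′ b′ d′ → mat a b 0B d · mat a′ b′ 0B d′ ≡ mat (a *B a′) (a *B b′ +B b *B d′) 0B (d *B d′)
upper-· a b d a′ b′ d′ = mat-≡
  (trans (cong (a *B a′ +B_) (zeroʳ b)) (+-identityʳ (a *B a′)))
  refl
  (trans (cong₂ _+B_ (zeroˡ a′) (zeroʳ d)) (+-identityʳ 0B))
  (trans (cong (_+B d *B d′) (zeroˡ b′)) (+B-identityˡ (d *B d′)))

diag-inverse : ∀ u w → u *B w ≡ 1B → w *B u ≡ 1B → IsInverse (diag u) (diag w)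
diag-inverse u w uw≡1 wu≡1 = diag-· u w uw≡1 , diag-· w u wu≡1
  where
  diag-· : ∀ x y → x *B y ≡ 1B → diag x · diag y ≡ I₂
  diag-· x y xy≡1 = trans (upper-· x 0B 1B y 0B 1B)
    (mat-≡ xy≡1 (trans (cong (_+B 0B *B 1B) (zeroʳ x)) (+B-identityˡ (0B *B 1B))) refl refl)

elem-inverse : ∀ v → IsInverse (elem v) (elem (-B v))
elem-inverse v = elem-· v (-B v) (+B-inverseˡ v) , elem-· (-B v) v (-‿inverseʳ v)
  where
  elem-· : ∀ x y → y +B x ≡ 0B → elem x · elem y ≡ I₂
  elem-· x y y+x≡0 = trans (upper-· 1B x 1B 1B y 1B)
    (mat-≡ refl (trans (cong₂ _+B_ (*B-identityˡ y) (*B-identityʳ x)) y+x≡0) refl refl)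

entries-· : ∀ M N → EntriesInO M → EntriesInO N → EntriesInO (M · N)
entries-· (mat _ _ _ _) (mat _ _ _ _) (a , b , c , d) (a′ , b′ , c′ , d′) =
  ∈O-+ (∈O-* a a′) (∈O-* b c′) , ∈O-+ (∈O-* a b′) (∈O-* b d′) ,
  ∈O-+ (∈O-* c a′) (∈O-* d c′) , ∈O-+ (∈O-* c b′) (∈O-* d d′)

GL-· : ∀ M N → InGL2O M → InGL2O N → InGL2O (M · N)
GL-· M N (M∈O , M′ , M′∈O , M⁻¹) (N∈O , N′ , N′∈O , N⁻¹) =
  entries-· M N M∈O N∈O , N′ · M′ , entries-· N′ M′ N′∈O M′∈O , inverse-· M M′ N N′ M⁻¹ N⁻¹

GL-inverse : ∀ M N → InGL2O M → IsInverse M N → InGL2O N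
GL-inverse M N (M∈O , M′ , M′∈O , M⁻¹) MN≡I =
  subst EntriesInO (inverse-unique M M′ N M⁻¹ MN≡I) M′∈O , M , M∈O , inverse-sym M N MN≡I

I₂∈GL : InGL2O I₂
I₂∈GL = (1∈O , 0∈O , 0∈O , 1∈O) , I₂ , (1∈O , 0∈O , 0∈O , 1∈O) , refl , refl

gen∈GL : ∀ {M} → Gen M → InGL2O M
gen∈GL gen-w = (0∈O , 1∈O , ∈O-neg 1∈O , 0∈O) , W⁻¹ , (0∈O , ∈O-neg 1∈O , 1∈O , 0∈O) , W-inverse
gen∈GL (gen-u u (u∈O , w , w∈O , uw≡1 , wu≡1)) =
  (u∈O , 0∈O , 0∈O , 1∈O) , diag w , (w∈O , 0∈O , 0∈O , 1∈O) , diag-inverse u w uw≡1 wu≡1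
gen∈GL (gen-v v v∈O) =
  (1∈O , v∈O , 0∈O , 1∈O) , elem (-B v) , (1∈O , ∈O-neg v∈O , 0∈O , 1∈O) , elem-inverse v

generated⇒GL : ∀ {M} → Generated M → InGL2O M
generated⇒GL (g-gen g)           = gen∈GL g
generated⇒GL g-one               = I₂∈GL
generated⇒GL (g-mul {M} {N} p q) = GL-· M N (generated⇒GL p) (generated⇒GL q)
generated⇒GL (g-inv {M} {N} p MN≡I) = GL-inverse M N (generated⇒GL p) MN≡I

W⁻¹·diag : ∀ d → W⁻¹ · diag d ≡ mat 0B (-B 1B) d 0B
W⁻¹·diag d = mat-≡ (trans (cong₂ _+B_ (zeroˡ d) (zeroʳ (-B 1B))) (+-identityʳ 0B)) refl
                   (trans (+-identityʳ (1B *B d)) (*B-identityˡ d)) refl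

W⁻¹·diag·W : ∀ d → (W⁻¹ · diag d) · W ≡ mat 1B 0B 0B d
W⁻¹·diag·W d = trans (cong (_· W) (W⁻¹·diag d))
  (mat-≡ refl refl (trans (cong₂ _+B_ (zeroʳ d) (zeroˡ (-B 1B))) (+-identityʳ 0B)) (trans (+-identityʳ (d *B 1B)) (*B-identityʳ d)))

lower-left-reduct : ∀ v a b c d → Mat2.m21 ((W⁻¹ · elem v) · mat a b c d) ≡ a +B v *B c
lower-left-reduct v a b c d =
  cong₂ _+B_ (*B-identityˡ a) (cong (_*B c) (trans (+-identityʳ (1B *B v)) (*B-identityˡ v)))

diag·elem : ∀ a d x → (diag a · mat 1B 0B 0B d) · elem x ≡ mat a (a *B x) 0B d
diag·elem a d x = begin
  (diag a · mat 1B 0B 0B d) · elem x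
    ≡⟨ cong (_· elem x) (trans (upper-· a 0B 1B 1B 0B d)
         (mat-≡ (*B-identityʳ a) (trans (cong₂ _+B_ (zeroʳ a) (zeroˡ d)) (+-identityʳ 0B)) refl (*B-identityˡ d))) ⟩
  mat a 0B 0B d · elem x
    ≡⟨ trans (upper-· a 0B d 1B x 1B) (mat-≡ (*B-identityʳ a) (trans (cong (a *B x +B_) (zeroˡ 1B)) (+-identityʳ (a *B x))) refl (*B-identityʳ d)) ⟩
  mat a (a *B x) 0B d ∎
  where open ≡-Reasoning

left-invertible⇒unit : ∀ {u w} → InO u → InO w → w *B u ≡ 1B → IsUnitO u
left-invertible⇒unit {u} {w} u∈O w∈O wu≡1 = u∈O , w , w∈O , inverseˡ⇒inverseʳ u∈O w∈O wu≡1 , wu≡1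

upper-triangular-generated : ∀ a b d → InGL2O (mat a b 0B d) → Generated (mat a b 0B d)
upper-triangular-generated a b d ((a∈O , b∈O , _ , d∈O) , mat n₁₁ n₁₂ n₂₁ n₂₂ , (n₁₁∈O , _ , _ , n₂₂∈O) , _ , NM≡I) =
  subst Generated factorisation
    (g-mul {diag a · D} {elem x} (g-mul {diag a} {D} (g-gen (gen-u a a-unit)) D-generated) (g-gen (gen-v x (∈O-* n₁₁∈O b∈O))))
  where
  open ≡-Reasoning
  drop-zero : ∀ x y → x +B y *B 0B ≡ x
  drop-zero x y = trans (cong (x +B_) (zeroʳ y)) (+-identityʳ x)
  n₁₁a≡1 : n₁₁ *B a ≡ 1B
  n₁₁a≡1 = trans (sym (drop-zero (n₁₁ *B a) n₁₂)) (cong Mat2.m11 NM≡I)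
  an₁₁≡1 : a *B n₁₁ ≡ 1B
  an₁₁≡1 = inverseˡ⇒inverseʳ a∈O n₁₁∈O n₁₁a≡1
  a-unit : IsUnitO a
  a-unit = a∈O , n₁₁ , n₁₁∈O , an₁₁≡1 , n₁₁a≡1
  n₂₁≡0 : n₂₁ ≡ 0B
  n₂₁≡0 = begin
    n₂₁                   ≡⟨ *B-identityʳ n₂₁ ⟨
    n₂₁ *B 1B             ≡⟨ cong (n₂₁ *B_) an₁₁≡1 ⟨
    n₂₁ *B (a *B n₁₁)     ≡⟨ *B-assoc n₂₁ a n₁₁ ⟨
    (n₂₁ *B a) *B n₁₁     ≡⟨ cong (_*B n₁₁) (trans (sym (drop-zero (n₂₁ *B a) n₂₂)) (cong Mat2.m21 NM≡I)) ⟩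
    0B *B n₁₁             ≡⟨ zeroˡ n₁₁ ⟩
    0B                    ∎
  n₂₂d≡1 : n₂₂ *B d ≡ 1B
  n₂₂d≡1 = begin
    n₂₂ *B d              ≡⟨ +B-identityˡ (n₂₂ *B d) ⟨
    0B +B n₂₂ *B d        ≡⟨ cong (_+B n₂₂ *B d) (trans (cong (_*B b) n₂₁≡0) (zeroˡ b)) ⟨
    n₂₁ *B b +B n₂₂ *B d  ≡⟨ cong Mat2.m22 NM≡I ⟩
    1B                    ∎
  x : B
  x = n₁₁ *B b
  D : Mat2
  D = (W⁻¹ · diag d) · W
  D-generated : Generated D
  D-generated = g-mul {W⁻¹ · diag d} {W} (g-mul {W⁻¹} {diag d} W⁻¹-generated (g-gen (gen-u d (left-invertible⇒unit d∈O n₂₂∈O n₂₂d≡1)))) (g-gen gen-w)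
  factorisation : (diag a · D) · elem x ≡ mat a b 0B d
  factorisation = begin
    (diag a · D) · elem x                  ≡⟨ cong (λ D′ → (diag a · D′) · elem x) (W⁻¹·diag·W d) ⟩
    (diag a · mat 1B 0B 0B d) · elem x     ≡⟨ diag·elem a d x ⟩
    mat a (a *B (n₁₁ *B b)) 0B d           ≡⟨ cong (λ z → mat a z 0B d) (*B-assoc a n₁₁ b) ⟨
    mat a ((a *B n₁₁) *B b) 0B d           ≡⟨ cong (λ z → mat a (z *B b) 0B d) an₁₁≡1 ⟩
    mat a (1B *B b) 0B d                   ≡⟨ cong (λ z → mat a z 0B d) (*B-identityˡ b) ⟩
    mat a b 0B d                           ∎

reductor : B → Mat2
reductor v = W⁻¹ · elem v

reductor-generated : ∀ {v} → InO v → Generated (reductor v)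
reductor-generated {v} v∈O = g-mul {W⁻¹} {elem v} W⁻¹-generated (g-gen (gen-v v v∈O))

generated-from-reduct : ∀ {v} M → InO v → Generated (reductor v · M) → Generated M
generated-from-reduct {v} M v∈O reduct-generated =
  subst Generated (cancel-inverse (elem (-B v) · W) (reductor v) M (proj₂ reductor⁻¹))
    (g-mul {elem (-B v) · W} {reductor v · M} (g-inv {reductor v} (reductor-generated v∈O) reductor⁻¹) reduct-generated)
  where
  reductor⁻¹ : IsInverse (reductor v) (elem (-B v) · W)
  reductor⁻¹ = inverse-· W⁻¹ W (elem v) (elem (-B v)) (inverse-sym W W⁻¹ W-inverse) (elem-inverse v)

GeneratedAtLowerLeftNorm : ℕ → Set
GeneratedAtLowerLeftNorm n = ∀ M γ → InGL2O M → Mat2.m21 M ≡ φ γ → ‖ γ ‖ ≡ n → Generated M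

generated-by-descent : ∀ n → GeneratedAtLowerLeftNorm n
generated-by-descent = <-rec GeneratedAtLowerLeftNorm descend
  where
  descend : ∀ n → (∀ {k} → k ℕ.< n → GeneratedAtLowerLeftNorm k) → GeneratedAtLowerLeftNorm n
  descend zero _ (mat a b c d) γ M∈GL c≡φγ ‖γ‖≡0 =
    subst (λ z → Generated (mat a b z d)) (sym c≡0) (upper-triangular-generated a b d (subst (λ z → InGL2O (mat a b z d)) c≡0 M∈GL))
    where
    c≡0 : c ≡ 0B
    c≡0 = trans c≡φγ (cong φ (‖‖≡0 γ ‖γ‖≡0))
  descend (suc m) descend-below M@(mat a b c d) γ M∈GL@((a∈O , _) , _) c≡φγ ‖γ‖≡n =
    generated-from-reduct M v∈O (descend-below ρ<n (reductor v · M) ρ (GL-· (reductor v) M (generated⇒GL (reductor-generated v∈O)) M∈GL) lower-left refl)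
    where
    open ≡-Reasoning
    α q ρ : Coords ℤ
    α = coordsOf a∈O
    q = proj₁ (euclidean α γ ‖γ‖≡n)
    ρ = α -ᴴ q *ᴴ γ
    ρ<n : ‖ ρ ‖ ℕ.< suc m
    ρ<n = proj₂ (euclidean α γ ‖γ‖≡n)
    v : B
    v = -B φ q
    v∈O : InO v
    v∈O = ∈O-neg (φ∈O q)
    lower-left : Mat2.m21 (reductor v · M) ≡ φ ρ
    lower-left = begin
      Mat2.m21 (reductor v · M)       ≡⟨ lower-left-reduct v a b c d ⟩
      a +B v *B c                     ≡⟨ cong₂ (λ x y → x +B v *B y) (coordsOf-φ a∈O) c≡φγ ⟩
      φ α +B (-B φ q) *B φ γ          ≡⟨ cong (φ α +B_) (-‿distribˡ-* (φ q) (φ γ)) ⟨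
      φ α +B -B (φ q *B φ γ)          ≡⟨ cong (λ x → φ α +B -B x) (φ-* q γ) ⟨
      φ α +B -B φ (q *ᴴ γ)             ≡⟨ φ-sub α (q *ᴴ γ) ⟨
      φ ρ                             ∎

GL⇒generated : ∀ M → InGL2O M → Generated M
GL⇒generated M M∈GL@((_ , _ , c∈O , _) , _) = generated-by-descent _ M (coordsOf c∈O) M∈GL (coordsOf-φ c∈O) refl

proposition2p2 : (M : Mat2) → (InGL2O M → Generated M) × (Generated M → InGL2O M)
proposition2p2 M = GL⇒generated M , generated⇒GL
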